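{- If $G$ is a bipartite $B_1$-EPG graph, then $G$ is a Helly-$B_1$-EPG graph.
   Context: All graphs are finite and simple. An EPG representation of a graph $G$ assigns to each vertex $v$ a path $P_v$ in the (rectangular) grid such that two distinct vertices are adjacent in $G$ if and only if their paths share at least one grid edge. A graph is $B_1$-EPG if it has an EPG representation in which every path has at most one bend. A $B_1$-EPG representation is Helly if every subfamily of its paths that pairwise share a grid edge has a grid edge common to all paths of the subfamily. A graph is Helly-$B_1$-EPG if it admits a Helly $B_1$-EPG representation. -}

module Defs where

open import Data.Nat using (ℕ)
open import Data.Fin using (Fin)
open import Data.Fin.Subset using (Subset; _∈_)
open import Data.Integer using (ℤ; _≤_; _<_; _⊓_; _⊔_)
open import Data.Bool using (Bool)
open import Data.Product using (Σ; ∃; _×_)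
open import Data.Sum using (_⊎_)
open import Relation.Nullary using (¬_)
open import Relation.Binary.PropositionalEquality using (_≡_; _≢_)
open import Function.Bundles using (_⇔_)

record Graph : Set₁ where
  field
    n     : ℕ
    Adj   : Fin n → Fin n → Set
    sym   : ∀ {u v} → Adj u v → Adj v u
    irrefl : ∀ {u} → ¬ Adj u u
open Graph public

Bipartite : Graph → Set
Bipartite G = Σ (Fin (n G) → Bool) λ c → ∀ {u v} → Adj G u v → c u ≢ c v

-- Grid edges of the integer grid ℤ × ℤ.
--   hor x y : the edge between (x , y) and (x + 1 , y)
--   ver x y : the edge between (x , y) and (x , y + 1)
data GridEdge : Set where
  hor : ℤ → ℤ → GridEdge
  ver : ℤ → ℤ → GridEdge

-- A grid path with at most one bend: a corner point (a , b), a horizontal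
-- segment from (a , b) to (c , b) and a vertical segment from (a , b) to
-- (a , d).  If c = a or d = b the path has no bend (a straight segment);
-- otherwise it has exactly one bend at (a , b).
record B1Path : Set where
  constructor mkPath
  field
    a b c d    : ℤ
    nontrivial : c ≢ a ⊎ d ≢ b

_∈ₚ_ : GridEdge → B1Path → Set
hor x y ∈ₚ mkPath a b c d _ = y ≡ b × (a ⊓ c ≤ x × x < a ⊔ c)
ver x y ∈ₚ mkPath a b c d _ = x ≡ a × (b ⊓ d ≤ y × y < b ⊔ d)

ShareEdge : B1Path → B1Path → Set
ShareEdge P Q = ∃ λ e → e ∈ₚ P × e ∈ₚ Q

IsB1EPGRep : (G : Graph) → (Fin (n G) → B1Path) → Set
IsB1EPGRep G P = ∀ u v → u ≢ v → (Adj G u v ⇔ ShareEdge (P u) (P v))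

IsHelly : (G : Graph) → (Fin (n G) → B1Path) → Set
IsHelly G P = (S : Subset (n G)) →
  (∀ u v → u ∈ S → v ∈ S → ShareEdge (P u) (P v)) →
  ∃ λ e → ∀ u → u ∈ S → e ∈ₚ P u

B1EPG : Graph → Set
B1EPG G = Σ (Fin (n G) → B1Path) λ P → IsB1EPGRep G P

HellyB1EPG : Graph → Set
HellyB1EPG G = Σ (Fin (n G) → B1Path) λ P → IsB1EPGRep G P × IsHelly G P

-- In a bipartite graph every clique has at most two vertices.  A family of
-- paths that pairwise share a grid edge represents a clique, so it consists
-- of at most two distinct paths, and the edge shared by those two (or any
-- edge of a single path) is common to the whole family.  Hence every B₁-EPG
-- representation of a bipartite graph is already Helly.
module Submission where

open import Defs
open import Data.Fin using (Fin; _≟_)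
open import Data.Fin.Properties using (any?)
open import Data.Fin.Subset using (_∈_)
open import Data.Fin.Subset.Properties using (_∈?_)
open import Data.Integer using (ℤ; 0ℤ; _<_; _⊓_; _⊔_)
open import Data.Integer.Properties
  using (≤-refl; <-cmp; <⇒≤; i≤j⇒i⊓j≡i; i≤j⇒i⊔j≡j; i≥j⇒i⊓j≡j; i≥j⇒i⊔j≡i)
open import Data.Bool using (Bool; true; false)
open import Data.Product using (∃; _,_)
open import Data.Sum using (inj₁; inj₂)
open import Data.Empty using (⊥; ⊥-elim)
open import Relation.Nullary using (yes; no)
open import Relation.Nullary.Decidable using (_×-dec_; ¬?)
open import Relation.Binary using (tri<; tri≈; tri>)
open import Relation.Binary.PropositionalEquality
  using (_≢_; refl; ≢-sym; subst₂) renaming (sym to ≡-sym)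
open import Function.Bundles using (Equivalence)

⊓<⊔ : ∀ {i j : ℤ} → i ≢ j → i ⊓ j < i ⊔ j
⊓<⊔ {i} {j} i≢j with <-cmp i j
... | tri< i<j _ _ =
  subst₂ _<_ (≡-sym (i≤j⇒i⊓j≡i (<⇒≤ i<j))) (≡-sym (i≤j⇒i⊔j≡j (<⇒≤ i<j))) i<j
... | tri≈ _ i≡j _ = ⊥-elim (i≢j i≡j)
... | tri> _ _ j<i =
  subst₂ _<_ (≡-sym (i≥j⇒i⊓j≡j (<⇒≤ j<i))) (≡-sym (i≥j⇒i⊔j≡i (<⇒≤ j<i))) j<i

edge-on : (P : B1Path) → ∃ λ e → e ∈ₚ P
edge-on (mkPath a b c d (inj₁ c≢a)) = hor (a ⊓ c) b , refl , ≤-refl , ⊓<⊔ (≢-sym c≢a)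
edge-on (mkPath a b c d (inj₂ d≢b)) = ver a (b ⊓ d) , refl , ≤-refl , ⊓<⊔ (≢-sym d≢b)

TriangleFree : Graph → Set
TriangleFree G = ∀ {u v w} → Adj G u v → Adj G v w → Adj G u w → ⊥

no-three-distinct-Bool : {x y z : Bool} → x ≢ y → y ≢ z → x ≢ z → ⊥
no-three-distinct-Bool {true}  {true}          x≢y _   _   = x≢y refl
no-three-distinct-Bool {false} {false}         x≢y _   _   = x≢y refl
no-three-distinct-Bool {true}  {false} {true}  _   _   x≢z = x≢z refl
no-three-distinct-Bool {true}  {false} {false} _   y≢z _   = y≢z refl
no-three-distinct-Bool {false} {true}  {true}  _   y≢z _   = y≢z refl
no-three-distinct-Bool {false} {true}  {false} _   _   x≢z = x≢z refl

bipartite⇒triangleFree : (G : Graph) → Bipartite G → TriangleFree G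
bipartite⇒triangleFree G (_ , proper) uv vw uw =
  no-three-distinct-Bool (proper uv) (proper vw) (proper uw)

-- The empty family has every grid edge in common; any one will do.
triangleFree⇒helly : (G : Graph) (P : Fin (n G) → B1Path) →
  TriangleFree G → IsB1EPGRep G P → IsHelly G P
triangleFree⇒helly G P triangleFree rep S pairwise
  with any? (_∈? S)
... | no S-empty = hor 0ℤ 0ℤ , λ u u∈S → ⊥-elim (S-empty (u , u∈S))
... | yes (u , u∈S) with any? (λ v → (v ∈? S) ×-dec ¬? (v ≟ u))
...   | no only-u-in-S with edge-on (P u)
...     | e , e∈Pu = e , on-all
  where
  on-all : ∀ w → w ∈ S → e ∈ₚ P w
  on-all w w∈S with w ≟ u
  ... | yes refl = e∈Pu
  ... | no w≢u   = ⊥-elim (only-u-in-S (w , w∈S , w≢u))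
triangleFree⇒helly G P triangleFree rep S pairwise
  | yes (u , u∈S) | yes (v , v∈S , v≢u) with pairwise u v u∈S v∈S
... | e , e∈Pu , e∈Pv = e , on-all
  where
  adjacent : ∀ {x y} → x ∈ S → y ∈ S → x ≢ y → Adj G x y
  adjacent {x} {y} x∈S y∈S x≢y = Equivalence.from (rep x y x≢y) (pairwise x y x∈S y∈S)

  on-all : ∀ w → w ∈ S → e ∈ₚ P w
  on-all w w∈S with w ≟ u | w ≟ v
  ... | yes refl | _        = e∈Pu
  ... | no _     | yes refl = e∈Pv
  ... | no w≢u   | no w≢v   =
    ⊥-elim (triangleFree (adjacent u∈S v∈S (≢-sym v≢u))
                         (adjacent v∈S w∈S (≢-sym w≢v))
                         (adjacent u∈S w∈S (≢-sym w≢u)))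

corollary1 : (G : Graph) → Bipartite G → B1EPG G → HellyB1EPG G
corollary1 G bipartite (P , rep) =
  P , rep , triangleFree⇒helly G P (bipartite⇒triangleFree G bipartite) rep
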